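{- Let $\gamma_1,\gamma_2$ be positive roots of $\mathrm{Sp}_{2n}$ with $\gamma_1\ne\gamma_2$ and $\mathrm{ht}(\gamma_1)\le\mathrm{ht}(\gamma_2)$, and suppose $(\gamma_1,\gamma_2)$ is not a bad pair. Then $s_{\gamma_1}(\gamma_2)=\gamma_2-\langle\gamma_2,\gamma_1^\vee\rangle\gamma_1$ is a positive root.
   Context: $n>1$. Roots of $\mathrm{Sp}_{2n}$ are taken with respect to the diagonal torus and the upper triangular Borel subgroup, with simple roots $\alpha_i(t)=a_i/a_{i+1}$ ($1\le i\le n-1$), $\beta(t)=a_n^2$ for $t=\mathrm{diag}(a_1,\dots,a_n,a_n^{ -1},\dots,a_1^{ -1})$. $\mathrm{ht}$ is the height, $\gamma^\vee$ the coroot, $s_\gamma$ the reflection in $\gamma$. A pair $(\gamma_1,\gamma_2)$ of positive roots is a bad pair if $\gamma_1\ne\gamma_2$, $\frac12\mathrm{ht}(\gamma_2)<\mathrm{ht}(\gamma_1)\le\mathrm{ht}(\gamma_2)$ and $\langle\gamma_2,\gamma_1^\vee\rangle=2$. -}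

module Defs where

open import Data.Nat using (ℕ; zero; suc)
import Data.Nat as ℕ
open import Data.Integer using (ℤ; _+_; _-_; _*_; +_; -_)
open import Data.Fin using (Fin; toℕ; _<_) renaming (_≟_ to _≟ᶠ_)
open import Data.Bool using (if_then_else_)
open import Relation.Nullary using (does)
open import Relation.Binary.PropositionalEquality using (_≡_)
open import Data.Product using (Σ; _×_)
open import Relation.Nullary using (¬_)
import Data.Integer as ℤ

-- Characters of the diagonal torus of Sp_{2n}: t = diag(a_1..a_n,a_n^{-1}..a_1^{-1})
-- ↦ ∏ a_i^{λ_i}, identified with λ : Fin n → ℤ (coordinates in the basis e_1..e_n).
Vecℤ : ℕ → Set
Vecℤ n = Fin n → ℤ

_≈_ : ∀ {n} → Vecℤ n → Vecℤ n → Set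
λ₁ ≈ λ₂ = ∀ m → λ₁ m ≡ λ₂ m

e : ∀ {n} → Fin n → Vecℤ n
e i m = if does (i ≟ᶠ m) then + 1 else + 0

_⊕_ : ∀ {n} → Vecℤ n → Vecℤ n → Vecℤ n
(u ⊕ v) m = u m + v m

_⊖_ : ∀ {n} → Vecℤ n → Vecℤ n → Vecℤ n
(u ⊖ v) m = u m - v m

_·_ : ∀ {n} → ℤ → Vecℤ n → Vecℤ n
(c · v) m = c * v m

Σℤ : ∀ n → (Fin n → ℤ) → ℤ
Σℤ zero f = + 0
Σℤ (suc n) f = f Data.Fin.zero + Σℤ n (λ k → f (Data.Fin.suc k))

⟪_,_⟫ : ∀ {n} → Vecℤ n → Vecℤ n → ℤ
⟪_,_⟫ {n} u v = Σℤ n (λ m → u m * v m)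

-- Positive roots of Sp_{2n} w.r.t. the diagonal torus and upper triangular Borel:
-- e_i - e_j (i<j), e_i + e_j (i<j), 2e_i.
data PosRoot {n : ℕ} : Vecℤ n → Set where
  diffR : ∀ {γ} (i j : Fin n) → i < j → γ ≈ (e i ⊖ e j) → PosRoot γ
  sumR  : ∀ {γ} (i j : Fin n) → i < j → γ ≈ (e i ⊕ e j) → PosRoot γ
  longR : ∀ {γ} (i : Fin n) → γ ≈ ((+ 2) · e i) → PosRoot γ

-- the coroot γ^∨ (a cocharacter, in the dual basis): (e_i ∓ e_j)^∨ = e_i ∓ e_j, (2e_i)^∨ = e_i
coroot : ∀ {n} {γ : Vecℤ n} → PosRoot γ → Vecℤ n
coroot (diffR i j _ _) = e i ⊖ e j
coroot (sumR i j _ _)  = e i ⊕ e j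
coroot (longR i _)     = e i

pair : ∀ {n} → Vecℤ n → {γ : Vecℤ n} → PosRoot γ → ℤ
pair λ′ p = ⟪ λ′ , coroot p ⟫

refl-s : ∀ {n} {γ : Vecℤ n} → PosRoot γ → Vecℤ n → Vecℤ n
refl-s {γ = γ} p λ′ = λ′ ⊖ ((pair λ′ p) · γ)

-- simple roots, indexed by k ∈ Fin n (0-based): α_{k+1} = e_k - e_{k+1} for k+1 < n,
-- and β = 2 e_{n-1} for the last index.
simple : ∀ {n} → Fin n → Vecℤ n
simple {suc zero} Data.Fin.zero = (+ 2) · e Data.Fin.zero
simple {suc (suc n)} Data.Fin.zero = e Data.Fin.zero ⊖ e (Data.Fin.suc Data.Fin.zero)
simple {suc (suc n)} (Data.Fin.suc k) m with m
... | Data.Fin.zero = + 0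
... | Data.Fin.suc m′ = simple k m′

expand : ∀ {n} → (Fin n → ℤ) → Vecℤ n
expand {n} c m = Σℤ n (λ k → c k * simple k m)

HasHeight : ∀ {n} → Vecℤ n → ℤ → Set
HasHeight {n} λ′ h = Σ (Fin n → ℤ) (λ c → (expand c ≈ λ′) × (Σℤ n c ≡ h))

-- (γ₁,γ₂) is a bad pair (heights h₁,h₂): γ₁ ≠ γ₂, ½h₂ < h₁ ≤ h₂, ⟨γ₂,γ₁^∨⟩ = 2.
-- (½h₂ < h₁ is written h₂ < 2h₁.)
BadPair : ∀ {n} {γ₁ γ₂ : Vecℤ n} → PosRoot γ₁ → PosRoot γ₂ → ℤ → ℤ → Set
BadPair {γ₁ = γ₁} {γ₂} p₁ p₂ h₁ h₂ =
  (¬ (γ₁ ≈ γ₂)) × (h₂ ℤ.< + 2 * h₁) × (h₁ ℤ.≤ h₂) × (pair γ₂ p₁ ≡ + 2)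

module Submission where

--  * Heights are measured by a cocharacter.  Let 2ρ∨ = (2n-1, …, 3, 1) (twice the
--    half-sum of the positive coroots).  It pairs to 2 with every simple root, hence
--    ⟨λ, 2ρ∨⟩ = 2·ht(λ) for every λ with a height; and its coordinates are positive
--    and strictly decreasing.
--
--  * Every root is a signed pair ±e_c ± e_d.  A reflection s_γ sends each basis
--    vector to a signed basis vector, so it maps signed pairs to signed pairs; it is
--    an involution, so it maps nonzero vectors to nonzero vectors.  A nonzero signed
--    pair with ⟨v, 2ρ∨⟩ ≥ 0 is a positive root (the dominance of 2ρ∨ rules out all
--    the negative ones).
--
-- For the theorem put k = ⟨γ₂, γ₁∨⟩.  Then ⟨s_{γ₁} γ₂, 2ρ∨⟩ = 2(h₂ - k h₁); the
-- coroot entries lie in {-1, 0, 1}, so k ≤ 2, and when k = 2 "not a bad pair" forces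
-- 2h₁ ≤ h₂.  Hence h₂ - k h₁ ≥ 0 and s_{γ₁} γ₂ is a positive root.

open import Defs
open import Data.Nat using (ℕ; zero; suc; z≤n; s≤s)
import Data.Nat as ℕ
import Data.Nat.Properties as ℕP
open import Data.Integer using (ℤ; _≤_; _<_; _+_; _-_; _*_; -_; +_; +[1+_]; -[1+_]; +≤+; +<+; _◃_)
import Data.Integer as ℤ
import Data.Integer.Properties as ℤP
open import Data.Integer.Tactic.RingSolver using (solve-∀)
open import Data.Sign using (Sign)
import Data.Sign as Sign
open import Data.Fin using (Fin; zero; suc; _≟_) renaming (_<_ to _<ᶠ_)
import Data.Fin.Properties as FinP
open import Data.Bool using (if_then_else_)
open import Data.Product using (_×_; _,_)
open import Data.Empty using (⊥-elim)
open import Function using (_∘_)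
open import Relation.Binary.Definitions using (tri<; tri≈; tri>)
open import Relation.Binary.PropositionalEquality
open import Relation.Nullary using (¬_; yes; no)
open import Relation.Nullary.Decidable using (True; toWitness; dec-true; dec-false)

Σ-cong : ∀ n {f g : Fin n → ℤ} → (∀ m → f m ≡ g m) → Σℤ n f ≡ Σℤ n g
Σ-cong zero    f≡g = refl
Σ-cong (suc n) f≡g = cong₂ _+_ (f≡g zero) (Σ-cong n (f≡g ∘ suc))

Σ-zero : ∀ n → Σℤ n (λ _ → + 0) ≡ + 0
Σ-zero zero    = refl
Σ-zero (suc n) = trans (ℤP.+-identityˡ _) (Σ-zero n)

Σ-+ : ∀ n (f g : Fin n → ℤ) → Σℤ n (λ m → f m + g m) ≡ Σℤ n f + Σℤ n g
Σ-+ zero    f g = refl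
Σ-+ (suc n) f g = trans (cong (_+_ (f zero + g zero)) (Σ-+ n (f ∘ suc) (g ∘ suc)))
                        (interchange (f zero) (g zero) _ _)
  where
    interchange : ∀ a b c d → (a + b) + (c + d) ≡ (a + c) + (b + d)
    interchange = solve-∀

Σ-*ˡ : ∀ n c (f : Fin n → ℤ) → Σℤ n (λ m → c * f m) ≡ c * Σℤ n f
Σ-*ˡ zero    c f = sym (ℤP.*-zeroʳ c)
Σ-*ˡ (suc n) c f = trans (cong (_+_ (c * f zero)) (Σ-*ˡ n c (f ∘ suc)))
                         (sym (ℤP.*-distribˡ-+ c (f zero) _))

Σ-*ʳ : ∀ n c (f : Fin n → ℤ) → Σℤ n (λ m → f m * c) ≡ Σℤ n f * c
Σ-*ʳ n c f = trans (Σ-cong n (λ m → ℤP.*-comm (f m) c))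
                   (trans (Σ-*ˡ n c f) (ℤP.*-comm c _))

Σ-swap : ∀ n k (f : Fin n → Fin k → ℤ) →
         Σℤ n (λ m → Σℤ k (f m)) ≡ Σℤ k (λ j → Σℤ n (λ m → f m j))
Σ-swap zero    k f = sym (Σ-zero k)
Σ-swap (suc n) k f = trans (cong (_+_ (Σℤ k (f zero))) (Σ-swap n k (f ∘ suc)))
                           (sym (Σ-+ k (f zero) _))

e-diag : ∀ {n} (i : Fin n) → e i i ≡ + 1
e-diag i = cong (λ b → if b then + 1 else + 0) (dec-true (i ≟ i) refl)

e-off : ∀ {n} {i m : Fin n} → ¬ i ≡ m → e i m ≡ + 0
e-off {i = i} {m} i≢m = cong (λ b → if b then + 1 else + 0) (dec-false (i ≟ m) i≢m)

⟪e⟫ : ∀ n (i : Fin n) (x : Vecℤ n) → ⟪ e i , x ⟫ ≡ x i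
⟪e⟫ (suc n) zero    x = trans (cong₂ _+_ (ℤP.*-identityˡ (x zero)) (Σ-zero n)) (ℤP.+-identityʳ _)
⟪e⟫ (suc n) (suc i) x = trans (ℤP.+-identityˡ _) (⟪e⟫ n i (x ∘ suc))

⟪⟫-cong : ∀ {n} {u v : Vecℤ n} (x : Vecℤ n) → u ≈ v → ⟪ u , x ⟫ ≡ ⟪ v , x ⟫
⟪⟫-cong {n} x u≈v = Σ-cong n (λ m → cong (_* x m) (u≈v m))

⟪⟫-⊕ : ∀ {n} (u v x : Vecℤ n) → ⟪ u ⊕ v , x ⟫ ≡ ⟪ u , x ⟫ + ⟪ v , x ⟫
⟪⟫-⊕ {n} u v x = trans (Σ-cong n (λ m → ℤP.*-distribʳ-+ (x m) (u m) (v m))) (Σ-+ n _ _)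

⟪⟫-· : ∀ {n} (c : ℤ) (u x : Vecℤ n) → ⟪ c · u , x ⟫ ≡ c * ⟪ u , x ⟫
⟪⟫-· {n} c u x = trans (Σ-cong n (λ m → ℤP.*-assoc c (u m) (x m))) (Σ-*ˡ n c _)

⟪⟫-⊖ : ∀ {n} (u v x : Vecℤ n) → ⟪ u ⊖ v , x ⟫ ≡ ⟪ u , x ⟫ - ⟪ v , x ⟫
⟪⟫-⊖ {n} u v x = begin
    Σℤ n (λ m → (u m - v m) * x m)
  ≡⟨ Σ-cong n (λ m → as-sum (u m) (v m) (x m)) ⟩
    Σℤ n (λ m → u m * x m + - + 1 * (v m * x m))
  ≡⟨ Σ-+ n _ _ ⟩
    ⟪ u , x ⟫ + Σℤ n (λ m → - + 1 * (v m * x m))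
  ≡⟨ cong (_+_ ⟪ u , x ⟫) (Σ-*ˡ n (- + 1) _) ⟩
    ⟪ u , x ⟫ + - + 1 * ⟪ v , x ⟫
  ≡⟨ as-difference ⟪ u , x ⟫ ⟪ v , x ⟫ ⟩
    ⟪ u , x ⟫ - ⟪ v , x ⟫ ∎
  where
    open ≡-Reasoning
    as-sum : ∀ a b y → (a - b) * y ≡ a * y + - + 1 * (b * y)
    as-sum = solve-∀
    as-difference : ∀ a b → a + - + 1 * b ≡ a - b
    as-difference = solve-∀

⟪⟫-basis-sum : ∀ {n} {v : Vecℤ n} (s t : ℤ) (c d : Fin n) → v ≈ ((s · e c) ⊕ (t · e d)) →
               (x : Vecℤ n) → ⟪ v , x ⟫ ≡ s * x c + t * x d
⟪⟫-basis-sum {n} s t c d v≈ x =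
  trans (⟪⟫-cong x v≈) (trans (⟪⟫-⊕ (s · e c) (t · e d) x)
    (cong₂ _+_ (trans (⟪⟫-· s (e c) x) (cong (s *_) (⟪e⟫ n c x)))
               (trans (⟪⟫-· t (e d) x) (cong (t *_) (⟪e⟫ n d x)))))

0ᵛ : ∀ {n} → Vecℤ n
0ᵛ _ = + 0

⟪0⟫ : ∀ {n} (x : Vecℤ n) → ⟪ 0ᵛ , x ⟫ ≡ + 0
⟪0⟫ {n} x = Σ-zero n

-- Reflections v ↦ v - ⟨v, γ∨⟩ γ for arbitrary γ, γ∨; refl-s p is reflect γ (coroot p).

reflect : ∀ {n} → Vecℤ n → Vecℤ n → Vecℤ n → Vecℤ n
reflect γ γ∨ v = v ⊖ (⟪ v , γ∨ ⟫ · γ)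

reflect-cong : ∀ {n} (γ γ∨ : Vecℤ n) {u v : Vecℤ n} → u ≈ v → reflect γ γ∨ u ≈ reflect γ γ∨ v
reflect-cong γ γ∨ u≈v m = cong₂ (λ a k → a - k * γ m) (u≈v m) (⟪⟫-cong γ∨ u≈v)

reflect-linear : ∀ {n} (γ γ∨ : Vecℤ n) (s t : ℤ) (u w : Vecℤ n) m →
  reflect γ γ∨ ((s · u) ⊕ (t · w)) m ≡ s * reflect γ γ∨ u m + t * reflect γ γ∨ w m
reflect-linear γ γ∨ s t u w m =
  trans (cong (λ k → (s * u m + t * w m) - k * γ m)
              (trans (⟪⟫-⊕ (s · u) (t · w) γ∨) (cong₂ _+_ (⟪⟫-· s u γ∨) (⟪⟫-· t w γ∨))))
        (distribute (u m) (w m) s t ⟪ u , γ∨ ⟫ ⟪ w , γ∨ ⟫ (γ m))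
  where
    distribute : ∀ a b s t p q g → (s * a + t * b) - (s * p + t * q) * g ≡ s * (a - p * g) + t * (b - q * g)
    distribute = solve-∀

reflect-involutive : ∀ {n} (γ γ∨ : Vecℤ n) → ⟪ γ , γ∨ ⟫ ≡ + 2 →
                     ∀ v → reflect γ γ∨ (reflect γ γ∨ v) ≈ v
reflect-involutive γ γ∨ γγ∨≡2 v m =
  trans (cong (λ k → (v m - ⟪ v , γ∨ ⟫ * γ m) - k * γ m) reflected-coefficient)
        (cancel (v m) ⟪ v , γ∨ ⟫ (γ m))
  where
    reflected-coefficient : ⟪ reflect γ γ∨ v , γ∨ ⟫ ≡ ⟪ v , γ∨ ⟫ - ⟪ v , γ∨ ⟫ * + 2
    reflected-coefficient = trans (⟪⟫-⊖ v (⟪ v , γ∨ ⟫ · γ) γ∨)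
      (cong (_-_ ⟪ v , γ∨ ⟫) (trans (⟪⟫-· ⟪ v , γ∨ ⟫ γ γ∨) (cong (⟪ v , γ∨ ⟫ *_) γγ∨≡2)))
    cancel : ∀ a k g → (a - k * g) - (k - k * + 2) * g ≡ a
    cancel = solve-∀

reflect-nonzero : ∀ {n} (γ γ∨ : Vecℤ n) → ⟪ γ , γ∨ ⟫ ≡ + 2 → ∀ {v} →
                  ¬ v ≈ 0ᵛ → ¬ reflect γ γ∨ v ≈ 0ᵛ
reflect-nonzero γ γ∨ γγ∨≡2 {v} v≉0 sv≈0 = v≉0 λ m → begin
    v m                               ≡⟨ sym (reflect-involutive γ γ∨ γγ∨≡2 v m) ⟩
    reflect γ γ∨ (reflect γ γ∨ v) m   ≡⟨ reflect-cong γ γ∨ sv≈0 m ⟩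
    + 0 - ⟪ 0ᵛ , γ∨ ⟫ * γ m           ≡⟨ cong (λ k → + 0 - k * γ m) (⟪0⟫ γ∨) ⟩
    + 0 ∎
  where open ≡-Reasoning

reflect-e : ∀ {n} (γ γ∨ : Vecℤ n) {g u : Vecℤ n} {c : Fin n} (κ : ℤ) → γ∨ c ≡ κ → γ ≈ g →
            (∀ m → e c m - κ * g m ≡ u m) → reflect γ γ∨ (e c) ≈ u
reflect-e {n} γ γ∨ {c = c} κ γ∨c≡κ γ≈g computation m =
  trans (cong₂ (λ k a → e c m - k * a) (trans (⟪e⟫ n c γ∨) γ∨c≡κ) (γ≈g m)) (computation m)

-- Twice the half-sum of positive coroots: 2ρ∨ = (2n-1, …, 3, 1), i.e. 2ρ∨ = 1 + ρ̃.

evenℕ : ℕ → ℕ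
evenℕ zero    = 0
evenℕ (suc k) = suc (suc (evenℕ k))

ρ̃ : ∀ {n} → Fin n → ℕ
ρ̃ {suc n} zero    = evenℕ n
ρ̃ {suc n} (suc m) = ρ̃ m

twoρ∨ : ∀ {n} → Vecℤ n
twoρ∨ m = +[1+ ρ̃ m ]

ρ̃-bounded : ∀ n (m : Fin (suc n)) → ρ̃ m ℕ.≤ evenℕ n
ρ̃-bounded n       zero    = ℕP.≤-refl
ρ̃-bounded (suc n) (suc m) = ℕP.m≤n⇒m≤o+n 2 (ρ̃-bounded n m)

ρ̃-decreasing : ∀ {n} {i j : Fin n} → i <ᶠ j → ρ̃ j ℕ.< ρ̃ i
ρ̃-decreasing {suc (suc n)} {zero}  {suc j} _         = s≤s (ℕP.m≤n⇒m≤1+n (ρ̃-bounded n j))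
ρ̃-decreasing {suc n}       {suc i} {suc j} (s≤s i<j) = ρ̃-decreasing i<j

twoρ∨-decreasing : ∀ {n} {i j : Fin n} → i <ᶠ j → twoρ∨ j < twoρ∨ i
twoρ∨-decreasing i<j = +<+ (s≤s (ρ̃-decreasing i<j))

simple-twoρ∨ : ∀ {n} (k : Fin n) → ⟪ simple k , twoρ∨ ⟫ ≡ + 2
simple-twoρ∨ {suc zero}    zero    = refl
simple-twoρ∨ {suc (suc n)} zero    = begin
    ⟪ e₀ ⊖ e₁ , twoρ∨ ⟫
      ≡⟨ ⟪⟫-⊖ e₀ e₁ twoρ∨ ⟩
    ⟪ e₀ , twoρ∨ ⟫ - ⟪ e₁ , twoρ∨ ⟫
      ≡⟨ cong₂ _-_ (⟪e⟫ (suc (suc n)) zero twoρ∨) (⟪e⟫ (suc (suc n)) (suc zero) twoρ∨) ⟩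
    (+ 2 + +[1+ evenℕ n ]) - +[1+ evenℕ n ]
      ≡⟨ cancel (+[1+ evenℕ n ]) ⟩
    + 2 ∎
  where
    open ≡-Reasoning
    e₀ e₁ : Vecℤ (suc (suc n))
    e₀ = e zero
    e₁ = e (suc zero)
    cancel : ∀ a → (+ 2 + a) - a ≡ + 2
    cancel = solve-∀
simple-twoρ∨ {suc (suc n)} (suc k) = trans (ℤP.+-identityˡ _) (simple-twoρ∨ k)

⟪expand⟫ : ∀ {n} (c : Fin n → ℤ) (x : Vecℤ n) →
           ⟪ expand c , x ⟫ ≡ Σℤ n (λ k → c k * ⟪ simple k , x ⟫)
⟪expand⟫ {n} c x = begin
    Σℤ n (λ m → Σℤ n (λ k → c k * simple k m) * x m)
  ≡⟨ Σ-cong n (λ m → sym (Σ-*ʳ n (x m) _)) ⟩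
    Σℤ n (λ m → Σℤ n (λ k → c k * simple k m * x m))
  ≡⟨ Σ-swap n n _ ⟩
    Σℤ n (λ k → Σℤ n (λ m → c k * simple k m * x m))
  ≡⟨ Σ-cong n (λ k → trans (Σ-cong n (λ m → ℤP.*-assoc (c k) _ _)) (Σ-*ˡ n (c k) _)) ⟩
    Σℤ n (λ k → c k * ⟪ simple k , x ⟫) ∎
  where open ≡-Reasoning

height-twoρ∨ : ∀ {n} {λ′ : Vecℤ n} {h : ℤ} → HasHeight λ′ h → ⟪ λ′ , twoρ∨ ⟫ ≡ + 2 * h
height-twoρ∨ {n} {λ′} {h} (c , expand≈ , Σc≡h) = begin
    ⟪ λ′ , twoρ∨ ⟫                             ≡⟨ sym (⟪⟫-cong twoρ∨ expand≈) ⟩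
    ⟪ expand c , twoρ∨ ⟫                       ≡⟨ ⟪expand⟫ c twoρ∨ ⟩
    Σℤ n (λ k → c k * ⟪ simple k , twoρ∨ ⟫)   ≡⟨ Σ-cong n (λ k → cong (c k *_) (simple-twoρ∨ k)) ⟩
    Σℤ n (λ k → c k * + 2)                     ≡⟨ Σ-*ʳ n (+ 2) c ⟩
    Σℤ n c * + 2                               ≡⟨ cong (_* + 2) Σc≡h ⟩
    h * + 2                                    ≡⟨ ℤP.*-comm h (+ 2) ⟩
    + 2 * h ∎
  where open ≡-Reasoning

reflect-height : ∀ {n} {γ v : Vecℤ n} (γ∨ : Vecℤ n) {h₁ h₂ : ℤ} →
                 HasHeight γ h₁ → HasHeight v h₂ →
                 ⟪ reflect γ γ∨ v , twoρ∨ ⟫ ≡ + 2 * (h₂ - ⟪ v , γ∨ ⟫ * h₁)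
reflect-height {γ = γ} {v} γ∨ {h₁} {h₂} H₁ H₂ = begin
    ⟪ reflect γ γ∨ v , twoρ∨ ⟫          ≡⟨ ⟪⟫-⊖ v (k · γ) twoρ∨ ⟩
    ⟪ v , twoρ∨ ⟫ - ⟪ k · γ , twoρ∨ ⟫   ≡⟨ cong₂ _-_ (height-twoρ∨ H₂)
                                              (trans (⟪⟫-· k γ twoρ∨) (cong (k *_) (height-twoρ∨ H₁))) ⟩
    + 2 * h₂ - k * (+ 2 * h₁)            ≡⟨ factor h₂ k h₁ ⟩
    + 2 * (h₂ - k * h₁) ∎
  where
    open ≡-Reasoning
    k : ℤ
    k = ⟪ v , γ∨ ⟫
    factor : ∀ a k b → + 2 * a - k * (+ 2 * b) ≡ + 2 * (a - k * b)
    factor = solve-∀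

root-pairing : ∀ {n} {γ : Vecℤ n} → PosRoot γ → Vecℤ n → ℤ
root-pairing (diffR a b _ _) x = x a - x b
root-pairing (sumR a b _ _)  x = x a + x b
root-pairing (longR a _)     x = + 2 * x a

⟪posRoot⟫ : ∀ {n} {γ : Vecℤ n} (p : PosRoot γ) (x : Vecℤ n) → ⟪ γ , x ⟫ ≡ root-pairing p x
⟪posRoot⟫ {n} (diffR a b _ γ≈) x =
  trans (⟪⟫-cong x γ≈) (trans (⟪⟫-⊖ (e a) (e b) x) (cong₂ _-_ (⟪e⟫ n a x) (⟪e⟫ n b x)))
⟪posRoot⟫ {n} (sumR a b _ γ≈)  x =
  trans (⟪⟫-cong x γ≈) (trans (⟪⟫-⊕ (e a) (e b) x) (cong₂ _+_ (⟪e⟫ n a x) (⟪e⟫ n b x)))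
⟪posRoot⟫ {n} (longR a γ≈)     x =
  trans (⟪⟫-cong x γ≈) (trans (⟪⟫-· (+ 2) (e a) x) (cong (+ 2 *_) (⟪e⟫ n a x)))

coroot-self : ∀ {n} {γ : Vecℤ n} (p : PosRoot γ) → ⟪ γ , coroot p ⟫ ≡ + 2
coroot-self p@(diffR a b a<b _) = trans (⟪posRoot⟫ p (coroot p))
  (cong₂ _-_ (cong₂ _-_ (e-diag a) (e-off (FinP.<⇒≢ a<b ∘ sym))) (cong₂ _-_ (e-off (FinP.<⇒≢ a<b)) (e-diag b)))
coroot-self p@(sumR a b a<b _)  = trans (⟪posRoot⟫ p (coroot p))
  (cong₂ _+_ (cong₂ _+_ (e-diag a) (e-off (FinP.<⇒≢ a<b ∘ sym))) (cong₂ _+_ (e-off (FinP.<⇒≢ a<b)) (e-diag b)))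
coroot-self p@(longR a _)       = trans (⟪posRoot⟫ p (coroot p)) (cong (+ 2 *_) (e-diag a))

0<x-y : ∀ {x y} → y < x → + 0 < x - y
0<x-y {x} {y} y<x = subst (_< x - y) (ℤP.+-inverseʳ y) (ℤP.+-monoˡ-< (- y) y<x)

-- Positive roots pair positively with the strictly dominant 2ρ∨.
posRoot-twoρ∨ : ∀ {n} {γ : Vecℤ n} → PosRoot γ → + 0 < ⟪ γ , twoρ∨ ⟫
posRoot-twoρ∨ p = subst (+ 0 <_) (sym (⟪posRoot⟫ p twoρ∨)) (positive p)
  where
    positive : ∀ {n} {γ : Vecℤ n} (p : PosRoot γ) → + 0 < root-pairing p twoρ∨
    positive (diffR a b a<b _) = 0<x-y (twoρ∨-decreasing a<b)
    positive (sumR a b _ _)    = +<+ (s≤s z≤n)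
    positive (longR a _)       = +<+ (s≤s z≤n)

posRoot-nonzero : ∀ {n} {γ : Vecℤ n} → PosRoot γ → ¬ γ ≈ 0ᵛ
posRoot-nonzero {n} p γ≈0 =
  ℤP.<-irrefl (sym (trans (⟪⟫-cong twoρ∨ γ≈0) (⟪0⟫ {n} twoρ∨))) (posRoot-twoρ∨ p)

height-nonneg : ∀ {n} {γ : Vecℤ n} {h : ℤ} → PosRoot γ → HasHeight γ h → + 0 ≤ h
height-nonneg {h = h} p H = half h (subst (+ 0 <_) (height-twoρ∨ H) (posRoot-twoρ∨ p))
  where
    half : ∀ h → + 0 < + 2 * h → + 0 ≤ h
    half (+ _)    _ = +≤+ z≤n
    half -[1+ _ ] ()

Bounded : ℤ → Set
Bounded y = (- + 1 ≤ y) × (y ≤ + 1)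

by-evaluation : ∀ {x y} {_ : True (x ℤ.≤? y)} → x ≤ y
by-evaluation {_} {_} {t} = toWitness t

coroot-bounded : ∀ {n} {γ : Vecℤ n} (p : PosRoot γ) x → Bounded (coroot p x)
coroot-bounded (diffR a b _ _) x with a ≟ x | b ≟ x
... | yes _ | yes _ = by-evaluation , by-evaluation
... | yes _ | no _  = by-evaluation , by-evaluation
... | no _  | yes _ = by-evaluation , by-evaluation
... | no _  | no _  = by-evaluation , by-evaluation
coroot-bounded (sumR a b a<b _) x with a ≟ x | b ≟ x
... | yes refl | yes refl = ⊥-elim (FinP.<⇒≢ a<b refl)
... | yes _    | no _     = by-evaluation , by-evaluation
... | no _     | yes _    = by-evaluation , by-evaluation
... | no _     | no _     = by-evaluation , by-evaluation
coroot-bounded (longR a _) x with a ≟ x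
... | yes _ = by-evaluation , by-evaluation
... | no _  = by-evaluation , by-evaluation

⟦_⟧ : Sign → ℤ
⟦ s ⟧ = s ◃ 1

⟦⟧-* : ∀ s t x → ⟦ s ⟧ * (⟦ t ⟧ * x) ≡ ⟦ s Sign.* t ⟧ * x
⟦⟧-* s t x = trans (sym (ℤP.*-assoc ⟦ s ⟧ ⟦ t ⟧ x)) (cong (_* x) (sym (ℤP.◃-distrib-* s t 1 1)))

⟦⟧-bounded : ∀ s {y} → Bounded y → ⟦ s ⟧ * y ≤ + 1
⟦⟧-bounded Sign.+ {y} (_ , y≤1)  = subst (_≤ + 1) (sym (ℤP.*-identityˡ y)) y≤1
⟦⟧-bounded Sign.- {y} (-1≤y , _) = subst (_≤ + 1) (sym (ℤP.-1*i≡-i y)) (ℤP.neg-mono-≤ -1≤y)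

data SignedBasis {n} (u : Vecℤ n) : Set where
  ±e : (σ : Sign) (c : Fin n) → u ≈ (⟦ σ ⟧ · e c) → SignedBasis u

-- A signed pair ±e_c ± e_d; the nonzero ones are exactly the roots of C_n.
record SignedPair {n} (v : Vecℤ n) : Set where
  constructor signedPair
  field
    σ τ    : Sign
    c d    : Fin n
    decomp : v ≈ ((⟦ σ ⟧ · e c) ⊕ (⟦ τ ⟧ · e d))

posRoot⇒signedPair : ∀ {n} {γ : Vecℤ n} → PosRoot γ → SignedPair γ
posRoot⇒signedPair (diffR a b _ γ≈) =
  signedPair Sign.+ Sign.- a b (λ m → trans (γ≈ m) (signed-difference (e a m) (e b m)))
  where
    signed-difference : ∀ A B → A - B ≡ + 1 * A + - + 1 * B
    signed-difference = solve-∀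
posRoot⇒signedPair (sumR a b _ γ≈)  =
  signedPair Sign.+ Sign.+ a b (λ m → trans (γ≈ m) (sum (e a m) (e b m)))
  where
    sum : ∀ A B → A + B ≡ + 1 * A + + 1 * B
    sum = solve-∀
posRoot⇒signedPair (longR a γ≈)     =
  signedPair Sign.+ Sign.+ a a (λ m → trans (γ≈ m) (double (e a m)))
  where
    double : ∀ A → + 2 * A ≡ + 1 * A + + 1 * A
    double = solve-∀

-- A basis vector with γ∨(c) = 0 is fixed.
fixed : ∀ C → C - + 0 ≡ + 1 * C
fixed = solve-∀

-- A positive-root reflection permutes the signed basis vectors:
--   s_{e_a - e_b} swaps e_a and e_b; s_{e_a + e_b} sends e_a ↦ -e_b, e_b ↦ -e_a;
--   s_{2e_a} sends e_a ↦ -e_a; all other basis vectors are fixed.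
reflect-basis : ∀ {n} {γ : Vecℤ n} (p : PosRoot γ) (c : Fin n) → SignedBasis (refl-s p (e c))
reflect-basis p@(diffR a b a<b γ≈) c with c ≟ a | c ≟ b
... | yes refl | _ = ±e Sign.+ b (reflect-e _ (coroot p) (+ 1)
    (cong₂ _-_ (e-diag c) (e-off (FinP.<⇒≢ a<b ∘ sym))) γ≈ (λ m → a↦b (e c m) (e b m)))
  where
    a↦b : ∀ A B → A - + 1 * (A - B) ≡ + 1 * B
    a↦b = solve-∀
... | no _ | yes refl = ±e Sign.+ a (reflect-e _ (coroot p) (- + 1)
    (cong₂ _-_ (e-off (FinP.<⇒≢ a<b)) (e-diag c)) γ≈ (λ m → b↦a (e a m) (e c m)))
  where
    b↦a : ∀ A B → B - - + 1 * (A - B) ≡ + 1 * A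
    b↦a = solve-∀
... | no c≢a | no c≢b = ±e Sign.+ c (reflect-e _ (coroot p) (+ 0)
    (cong₂ _-_ (e-off (c≢a ∘ sym)) (e-off (c≢b ∘ sym))) γ≈ (λ m → fixed (e c m)))
reflect-basis p@(sumR a b a<b γ≈) c with c ≟ a | c ≟ b
... | yes refl | _ = ±e Sign.- b (reflect-e _ (coroot p) (+ 1)
    (cong₂ _+_ (e-diag c) (e-off (FinP.<⇒≢ a<b ∘ sym))) γ≈ (λ m → a↦-b (e c m) (e b m)))
  where
    a↦-b : ∀ A B → A - + 1 * (A + B) ≡ - + 1 * B
    a↦-b = solve-∀
... | no _ | yes refl = ±e Sign.- a (reflect-e _ (coroot p) (+ 1)
    (cong₂ _+_ (e-off (FinP.<⇒≢ a<b)) (e-diag c)) γ≈ (λ m → b↦-a (e a m) (e c m)))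
  where
    b↦-a : ∀ A B → B - + 1 * (A + B) ≡ - + 1 * A
    b↦-a = solve-∀
... | no c≢a | no c≢b = ±e Sign.+ c (reflect-e _ (coroot p) (+ 0)
    (cong₂ _+_ (e-off (c≢a ∘ sym)) (e-off (c≢b ∘ sym))) γ≈ (λ m → fixed (e c m)))
reflect-basis p@(longR a γ≈) c with c ≟ a
... | yes refl = ±e Sign.- c (reflect-e _ (coroot p) (+ 1) (e-diag c) γ≈ (λ m → a↦-a (e c m)))
  where
    a↦-a : ∀ A → A - + 1 * (+ 2 * A) ≡ - + 1 * A
    a↦-a = solve-∀
... | no c≢a = ±e Sign.+ c (reflect-e _ (coroot p) (+ 0) (e-off (c≢a ∘ sym)) γ≈ (λ m → fixed (e c m)))

reflect-signedPair : ∀ {n} {γ v : Vecℤ n} (p : PosRoot γ) → SignedPair v → SignedPair (refl-s p v)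
reflect-signedPair {γ = γ} {v} p (signedPair σ τ c d decomp)
  with reflect-basis p c | reflect-basis p d
... | ±e σ′ c′ image-c | ±e τ′ d′ image-d =
  signedPair (σ Sign.* σ′) (τ Sign.* τ′) c′ d′ λ m → begin
    refl-s p v m
      ≡⟨ reflect-cong γ (coroot p) decomp m ⟩
    s ((⟦ σ ⟧ · e c) ⊕ (⟦ τ ⟧ · e d)) m
      ≡⟨ reflect-linear γ (coroot p) ⟦ σ ⟧ ⟦ τ ⟧ (e c) (e d) m ⟩
    ⟦ σ ⟧ * s (e c) m + ⟦ τ ⟧ * s (e d) m
      ≡⟨ cong₂ (λ x y → ⟦ σ ⟧ * x + ⟦ τ ⟧ * y) (image-c m) (image-d m) ⟩
    ⟦ σ ⟧ * (⟦ σ′ ⟧ * e c′ m) + ⟦ τ ⟧ * (⟦ τ′ ⟧ * e d′ m)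
      ≡⟨ cong₂ _+_ (⟦⟧-* σ σ′ (e c′ m)) (⟦⟧-* τ τ′ (e d′ m)) ⟩
    ⟦ σ Sign.* σ′ ⟧ * e c′ m + ⟦ τ Sign.* τ′ ⟧ * e d′ m ∎
  where
    open ≡-Reasoning
    s : Vecℤ _ → Vecℤ _
    s = reflect γ (coroot p)

pairing-bound : ∀ {n} {γ v : Vecℤ n} (p : PosRoot γ) → SignedPair v → pair v p ≤ + 2
pairing-bound p (signedPair σ τ c d decomp) =
  subst (_≤ + 2) (sym (⟪⟫-basis-sum ⟦ σ ⟧ ⟦ τ ⟧ c d decomp (coroot p)))
        (ℤP.+-mono-≤ (⟦⟧-bounded σ (coroot-bounded p c)) (⟦⟧-bounded τ (coroot-bounded p d)))

difference : ∀ A B → + 1 * A + - + 1 * B ≡ A - B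
difference = solve-∀

module _ {n : ℕ} {v : Vecℤ n} where

  sameSigns⇒posRoot : ∀ c d → v ≈ (((+ 1) · e c) ⊕ ((+ 1) · e d)) → PosRoot v
  sameSigns⇒posRoot c d v≈ with FinP.<-cmp c d
  ... | tri< c<d _ _ = sumR c d c<d (λ m → trans (v≈ m) (ordered (e c m) (e d m)))
    where
      ordered : ∀ A B → + 1 * A + + 1 * B ≡ A + B
      ordered = solve-∀
  ... | tri≈ _ refl _ = longR c (λ m → trans (v≈ m) (double (e c m)))
    where
      double : ∀ A → + 1 * A + + 1 * A ≡ + 2 * A
      double = solve-∀
  ... | tri> _ _ d<c = sumR d c d<c (λ m → trans (v≈ m) (swapped (e c m) (e d m)))
    where
      swapped : ∀ A B → + 1 * A + + 1 * B ≡ B + A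
      swapped = solve-∀

  -- e_c - e_d is a positive root when c < d, zero when c = d, and has negative
  -- pairing with 2ρ∨ when c > d.
  mixedSigns⇒posRoot : ∀ c d → v ≈ (((+ 1) · e c) ⊕ ((- + 1) · e d)) →
                       + 0 ≤ ⟪ v , twoρ∨ ⟫ → ¬ v ≈ 0ᵛ → PosRoot v
  mixedSigns⇒posRoot c d v≈ nonneg nonzero with FinP.<-cmp c d
  ... | tri< c<d _ _ = diffR c d c<d (λ m → trans (v≈ m) (difference (e c m) (e d m)))
  ... | tri≈ _ refl _ = ⊥-elim (nonzero (λ m → trans (v≈ m) (cancel (e c m))))
    where
      cancel : ∀ A → + 1 * A + - + 1 * A ≡ + 0
      cancel = solve-∀
  ... | tri> _ _ d<c = ⊥-elim (ℤP.<⇒≱ (twoρ∨-decreasing d<c) (ℤP.0≤i-j⇒j≤i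
          (subst (+ 0 ≤_) (trans (⟪⟫-basis-sum (+ 1) (- + 1) c d v≈ twoρ∨)
                                 (difference (twoρ∨ c) (twoρ∨ d))) nonneg)))

  signedPair⇒posRoot : SignedPair v → + 0 ≤ ⟪ v , twoρ∨ ⟫ → ¬ v ≈ 0ᵛ → PosRoot v
  signedPair⇒posRoot (signedPair Sign.+ Sign.+ c d v≈) _ _ = sameSigns⇒posRoot c d v≈
  signedPair⇒posRoot (signedPair Sign.+ Sign.- c d v≈) nonneg nonzero =
    mixedSigns⇒posRoot c d v≈ nonneg nonzero
  signedPair⇒posRoot (signedPair Sign.- Sign.+ c d v≈) nonneg nonzero =
    mixedSigns⇒posRoot d c (λ m → trans (v≈ m) (ℤP.+-comm (- + 1 * e c m) (+ 1 * e d m))) nonneg nonzero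
  signedPair⇒posRoot (signedPair Sign.- Sign.- c d v≈) nonneg _ =
    ⊥-elim (negative (ρ̃ c) (ρ̃ d) (subst (+ 0 ≤_) (⟪⟫-basis-sum (- + 1) (- + 1) c d v≈ twoρ∨) nonneg))
    where
      negative : ∀ A B → ¬ (+ 0 ≤ - + 1 * +[1+ A ] + - + 1 * +[1+ B ])
      negative A B ()

coefficient-bound : ∀ k h₁ h₂ → + 0 ≤ h₁ → h₁ ≤ h₂ → k ≤ + 2 →
                    (k ≡ + 2 → + 2 * h₁ ≤ h₂) → k * h₁ ≤ h₂
coefficient-bound k (+ a) h₂ _ h₁≤h₂ k≤2 k≡2⇒ with k ℤ.≟ + 2
... | yes refl = k≡2⇒ refl
... | no k≢2  = ℤP.≤-trans (ℤP.*-monoʳ-≤-nonNeg (+ a) k≤1)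
                           (subst (_≤ h₂) (sym (ℤP.*-identityˡ (+ a))) h₁≤h₂)
  where
    k≤1 : k ≤ + 1
    k≤1 = ℤP.i<j⇒i≤pred[j] (ℤP.≤∧≢⇒< k≤2 k≢2)

not-bad : ∀ {n} {γ₁ γ₂ : Vecℤ n} (p₁ : PosRoot γ₁) (p₂ : PosRoot γ₂) {h₁ h₂ : ℤ} →
          ¬ γ₁ ≈ γ₂ → h₁ ≤ h₂ → ¬ BadPair p₁ p₂ h₁ h₂ →
          pair γ₂ p₁ ≡ + 2 → + 2 * h₁ ≤ h₂
not-bad p₁ p₂ {h₁} {h₂} γ₁≉γ₂ h₁≤h₂ not-bad-pair k≡2 with h₂ ℤ.<? + 2 * h₁
... | yes h₂<2h₁ = ⊥-elim (not-bad-pair (γ₁≉γ₂ , h₂<2h₁ , h₁≤h₂ , k≡2))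
... | no h₂≮2h₁  = ℤP.≮⇒≥ h₂≮2h₁

lemma3p4 : (n : ℕ) → 2 ℕ.≤ n → {γ₁ γ₂ : Vecℤ n} (p₁ : PosRoot γ₁) (p₂ : PosRoot γ₂)
    → (h₁ h₂ : ℤ) → HasHeight γ₁ h₁ → HasHeight γ₂ h₂
    → ¬ (γ₁ ≈ γ₂) → h₁ ≤ h₂ → ¬ BadPair p₁ p₂ h₁ h₂
    → PosRoot (refl-s p₁ γ₂)
lemma3p4 n _ {γ₁} {γ₂} p₁ p₂ h₁ h₂ H₁ H₂ γ₁≉γ₂ h₁≤h₂ not-bad-pair =
  signedPair⇒posRoot (reflect-signedPair p₁ γ₂-signed) nonneg nonzero
  where
    γ₂-signed : SignedPair γ₂
    γ₂-signed = posRoot⇒signedPair p₂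
    kh₁≤h₂ : pair γ₂ p₁ * h₁ ≤ h₂
    kh₁≤h₂ = coefficient-bound (pair γ₂ p₁) h₁ h₂ (height-nonneg p₁ H₁) h₁≤h₂
               (pairing-bound p₁ γ₂-signed) (not-bad p₁ p₂ γ₁≉γ₂ h₁≤h₂ not-bad-pair)
    nonneg : + 0 ≤ ⟪ refl-s p₁ γ₂ , twoρ∨ ⟫
    nonneg = subst (+ 0 ≤_) (sym (reflect-height (coroot p₁) H₁ H₂))
                   (ℤP.*-monoˡ-≤-nonNeg (+ 2) (ℤP.i≤j⇒0≤j-i kh₁≤h₂))
    nonzero : ¬ refl-s p₁ γ₂ ≈ 0ᵛ
    nonzero = reflect-nonzero γ₁ (coroot p₁) (coroot-self p₁) (posRoot-nonzero p₂)
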